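{- Fix an integer $m \geq 2$. Suppose $n > m$ and $G \subseteq S_n$ is a permutation group acting on $\{1,\ldots,n\}$ such that: (i) $G$ is transitive; (ii) $G$ contains a cycle $\sigma$ with $n - m \leq \operatorname{len}(\sigma) < n$; (iii) $G$ contains a transposition; (iv) $G$ contains a $q$-cycle for some prime $q > m$. Then $G = S_n$.
   Context: $\operatorname{len}(\sigma)$ denotes the length of the cycle $\sigma$. -}

module Defs where

open import Data.Nat using (ℕ; zero; suc; _≤_)
open import Data.Fin using (Fin; zero; suc)
open import Data.Fin.Permutation using (Permutation′; _⟨$⟩ʳ_; id; flip; _∘ₚ_; _≈_)
open import Data.Maybe using (Maybe; just; nothing)
import Data.Maybe as Maybe
open import Data.Product using (Σ; ∃; _×_)
open import Relation.Binary.PropositionalEquality using (_≡_; _≢_)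
open import Function.Definitions using (Injective)

-- Cyclic successor on Fin k : i ↦ i + 1 (mod k).
lowerLast : ∀ {k} → Fin (suc k) → Maybe (Fin k)
lowerLast {zero} zero = nothing
lowerLast {suc k} zero = just zero
lowerLast {suc k} (suc i) = Maybe.map suc (lowerLast i)

cycSucc : ∀ {k} → Fin k → Fin k
cycSucc {suc k} i with lowerLast i
... | just j = suc j
... | nothing = zero

IsCycleOfLength : ∀ {n} → Permutation′ n → ℕ → Set
IsCycleOfLength {n} σ k =
  2 ≤ k × Σ (Fin k → Fin n) λ a →
    Injective _≡_ _≡_ a
    × (∀ i → σ ⟨$⟩ʳ a i ≡ a (cycSucc i))
    × (∀ x → (∀ i → a i ≢ x) → σ ⟨$⟩ʳ x ≡ x)

record IsPermGroup {n} (G : Permutation′ n → Set) : Set where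
  field
    resp    : ∀ {σ τ} → σ ≈ τ → G σ → G τ
    id-mem  : G id
    ∘-mem   : ∀ {σ τ} → G σ → G τ → G (σ ∘ₚ τ)
    inv-mem : ∀ {σ} → G σ → G (flip σ)

IsTransitive : ∀ {n} → (Permutation′ n → Set) → Set
IsTransitive {n} G = ∀ (i j : Fin n) → ∃ λ g → G g × g ⟨$⟩ʳ i ≡ j

{-# OPTIONS --safe #-}
module Submission where

-- Call i ∼ j when G contains the transposition (i j).  Conjugation shows that
-- ∼ is a G-invariant equivalence relation, so by transitivity of G all its
-- classes have the same size, and G = Sₙ as soon as ∼ is total.  Conjugating
-- the transposition into the support of the prime q-cycle ρ relates a point
-- of that support to another point; invariance under ρ, together with
-- Bézout's identity when the other point is in the support too, puts the
-- whole support into one class, so every class has at least q > m points.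
-- A class of size > m cannot avoid the support of σ, whose complement has
-- at most m points; invariance under σ then merges every class with the one
-- containing the support of σ.

open import Defs
open import Data.Nat using (ℕ; zero; suc; _≤_; _<_; _∸_; _+_; _*_; s≤s; z≤n; NonZero)
open import Data.Nat.Properties using (+-assoc; +-identityʳ; m∸n+n≡m; <⇒≤; m≤n+m∸n; +-mono-<-≤; ≤-<-trans)
open import Data.Nat.DivMod using (_%_; _mod_; %-distribˡ-+; m%n%n≡m%n; m<n⇒m%n≡m; n%n≡0; [m+n]%n≡m%n; [m+kn]%n≡m%n)
open import Data.Nat.Primality using (Prime)
open import Data.Nat.Coprimality using (Coprime; prime⇒coprime; coprime-Bézout)
open import Data.Nat.GCD using (module Bézout)
open import Data.Fin using (Fin; zero; suc; toℕ; _≟_; splitAt; join)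
open import Data.Fin.Properties using (toℕ-injective; toℕ<n; toℕ-fromℕ<; fromℕ<-cong; fromℕ<-toℕ; any?; ¬∀⟶∃¬; <⇒notInjective; join-splitAt)
open import Data.Fin.Permutation using (Permutation′; _⟨$⟩ʳ_; _⟨$⟩ˡ_; id; flip; _∘ₚ_; _≈_; transpose; inverseˡ; inverseʳ)
import Data.Fin.Permutation.Components as PC
open import Data.Fin.Permutation.Transposition.List using (TranspositionList; eval; decompose; eval-decompose)
open import Data.Vec.Functional using (_++_)
open import Data.List using ([]; _∷_)
open import Data.Maybe using (just; nothing)
open import Data.Product using (∃; ∃₂; _×_; _,_; proj₁; proj₂)
open import Data.Sum using (inj₁; inj₂)
open import Data.Empty using (⊥-elim)
open import Relation.Nullary using (yes; no; ¬_)
open import Relation.Binary using (Rel; IsEquivalence)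
open import Relation.Binary.PropositionalEquality
  using (_≡_; _≢_; refl; sym; trans; cong; subst; subst₂; module ≡-Reasoning)
open import Function.Bundles using (Injection)
open import Function.Definitions using (Injective)
open import Function.Properties.Inverse using (↔⇒↣)

private
  variable
    n : ℕ

injective⇒missesPoint : ∀ {k} {e : Fin k → Fin n} → Injective _≡_ _≡_ e → k < n →
                        ∃ λ x → ∀ j → e j ≢ x
injective⇒missesPoint {n} {e = e} e-inj k<n
  with ¬∀⟶∃¬ n (λ x → ∃ λ j → e j ≡ x) (λ x → any? (λ j → e j ≟ x)) notSurjective
  where
  notSurjective : ¬ (∀ x → ∃ λ j → e j ≡ x)
  notSurjective surj = <⇒notInjective k<n section-injective
    where
    section-injective : Injective _≡_ _≡_ (λ x → proj₁ (surj x))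
    section-injective {x} {y} eq =
      trans (sym (proj₂ (surj x))) (trans (cong e eq) (proj₂ (surj y)))
... | x , unhit = x , λ j ej → unhit (j , ej)

splitAt-injective : ∀ p {k} → Injective _≡_ _≡_ (splitAt p {k})
splitAt-injective p {k} {x} {y} eq =
  trans (sym (join-splitAt p k x)) (trans (cong (join p k) eq) (join-splitAt p k y))

++-injective : ∀ {p k} {f : Fin p → Fin n} {e : Fin k → Fin n} →
               Injective _≡_ _≡_ f → Injective _≡_ _≡_ e → (∀ i j → f i ≢ e j) →
               Injective _≡_ _≡_ (f ++ e)
++-injective {p = p} {k} f-inj e-inj disjoint {x} {y} eq
  with splitAt p x in x≡ | splitAt p y in y≡
... | inj₁ a | inj₁ b = splitAt-injective p (trans x≡ (trans (cong inj₁ (f-inj eq)) (sym y≡)))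
... | inj₂ a | inj₂ b = splitAt-injective p (trans x≡ (trans (cong inj₂ (e-inj eq)) (sym y≡)))
... | inj₁ a | inj₂ b = ⊥-elim (disjoint a b eq)
... | inj₂ a | inj₁ b = ⊥-elim (disjoint b a (sym eq))

injective-imagesMeet : ∀ {p k} {f : Fin p → Fin n} {e : Fin k → Fin n} →
                       Injective _≡_ _≡_ f → Injective _≡_ _≡_ e → n < p + k →
                       ∃₂ λ i j → f i ≡ e j
injective-imagesMeet {f = f} {e} f-inj e-inj n<p+k with any? (λ i → any? (λ j → f i ≟ e j))
... | yes (i , j , fi≡ej) = i , j , fi≡ej
... | no disjoint = ⊥-elim (<⇒notInjective n<p+k
        (++-injective f-inj e-inj (λ i j fi≡ej → disjoint (i , j , fi≡ej))))

lowerLast-just : ∀ {k} (j : Fin (suc k)) {j′} → lowerLast j ≡ just j′ → toℕ j′ ≡ toℕ j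
lowerLast-just {suc k} zero    refl = refl
lowerLast-just {suc k} (suc j) eq with lowerLast j in e
lowerLast-just {suc k} (suc j) refl | just _ = cong suc (lowerLast-just j e)

lowerLast-nothing : ∀ {k} (j : Fin (suc k)) → lowerLast j ≡ nothing → toℕ j ≡ k
lowerLast-nothing {zero}  zero    refl = refl
lowerLast-nothing {suc k} (suc j) eq with lowerLast j in e
lowerLast-nothing {suc k} (suc j) refl | nothing = cong suc (lowerLast-nothing j e)

toℕ-cycSucc : ∀ {k} (j : Fin (suc k)) → toℕ (cycSucc j) ≡ suc (toℕ j) % suc k
toℕ-cycSucc {k} j with lowerLast j in e
... | just j′ = trans (cong suc (lowerLast-just j e))
                      (sym (m<n⇒m%n≡m (s≤s (subst (_< k) (lowerLast-just j e) (toℕ<n j′)))))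
... | nothing = trans (sym (n%n≡0 (suc k))) (cong (λ t → suc t % suc k) (sym (lowerLast-nothing j e)))

suc-% : ∀ i d .{{_ : NonZero d}} → suc (i % d) % d ≡ suc i % d
suc-% i d = trans (%-distribˡ-+ 1 (i % d) d)
  (trans (cong (λ t → (1 % d + t) % d) (m%n%n≡m%n i d)) (sym (%-distribˡ-+ 1 i d)))

cycSucc-mod : ∀ k i → cycSucc (i mod suc k) ≡ suc i mod suc k
cycSucc-mod k i = toℕ-injective (begin
  toℕ (cycSucc (i mod suc k))     ≡⟨ toℕ-cycSucc (i mod suc k) ⟩
  suc (toℕ (i mod suc k)) % suc k ≡⟨ cong (λ t → suc t % suc k) (toℕ-fromℕ< _) ⟩
  suc (i % suc k) % suc k         ≡⟨ suc-% i (suc k) ⟩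
  suc i % suc k                   ≡⟨ toℕ-fromℕ< _ ⟨
  toℕ (suc i mod suc k)           ∎)
  where open ≡-Reasoning

toℕ-mod : ∀ k (j : Fin (suc k)) → toℕ j mod suc k ≡ j
toℕ-mod k j = trans (fromℕ<-cong _ _ (m<n⇒m%n≡m (toℕ<n j)) _ (toℕ<n j)) (fromℕ<-toℕ j _)

mod-cong : ∀ k i j → i % suc k ≡ j % suc k → i mod suc k ≡ j mod suc k
mod-cong k i j eq = fromℕ<-cong _ _ eq _ _

module _ (q : ℕ) .{{_ : NonZero q}} where

  successor-closed⇒all : ∀ {p} (P : ℕ → Set p) → (∀ {i j} → i % q ≡ j % q → P i → P j) →
                         (∀ {i} → P i → P (suc i)) → ∀ {t} → t ≤ q → P t → ∀ i → P i
  successor-closed⇒all P P-resp P-suc {t} t≤q Pt i = P-resp i+q∸t+t≡i (P-+t (i + (q ∸ t)))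
    where
    P-+t : ∀ r → P (r + t)
    P-+t zero    = Pt
    P-+t (suc r) = P-suc (P-+t r)
    i+q∸t+t≡i : (i + (q ∸ t) + t) % q ≡ i % q
    i+q∸t+t≡i = trans (cong (_% q) (trans (+-assoc i (q ∸ t) t) (cong (i +_) (m∸n+n≡m t≤q))))
                      ([m+n]%n≡m%n i q)

  module _ {a ℓ} {A : Set a} {_∼_ : Rel A ℓ} (∼-equiv : IsEquivalence _∼_) (b : ℕ → A)
           (b-periodic : ∀ {i j} → i % q ≡ j % q → b i ≡ b j)
           (b-shift : ∀ {i j} → b i ∼ b j → b (suc i) ∼ b (suc j)) where
    open IsEquivalence ∼-equiv renaming (refl to ∼-refl; sym to ∼-sym; trans to ∼-trans)

    private
      shift : ∀ r {i j} → b i ∼ b j → b (r + i) ∼ b (r + j)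
      shift zero    bi∼bj = bi∼bj
      shift (suc r) bi∼bj = b-shift (shift r bi∼bj)

      +-closed : ∀ {i j} → b i ∼ b 0 → b j ∼ b 0 → b (j + i) ∼ b 0
      +-closed {i} {j} bi∼b0 bj∼b0 =
        ∼-trans (subst (λ t → b (j + i) ∼ b t) (+-identityʳ j) (shift j bi∼b0)) bj∼b0

      *-closed : ∀ {t} → b t ∼ b 0 → ∀ x → b (x * t) ∼ b 0
      *-closed bt∼b0 zero    = ∼-refl
      *-closed bt∼b0 (suc x) = +-closed (*-closed bt∼b0 x) bt∼b0

    -- Bézout gives y with y t ≡ ±1 (mod q); in the case y t ≡ -1, shifting by 1 turns it into 0.
    coprime⇒connected : ∀ {t} → Coprime q t → b t ∼ b 0 → ∀ i → b i ∼ b 0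
    coprime⇒connected {t} q⊥t bt∼b0 = successor-closed⇒all (λ i → b i ∼ b 0)
      (λ i≡j → subst (λ x → x ∼ b 0) (b-periodic i≡j)) (λ bi∼b0 → +-closed bi∼b0 b1∼b0) {0} z≤n ∼-refl
      where
      b1∼b0 : b 1 ∼ b 0
      b1∼b0 with coprime-Bézout q⊥t
      ... | Bézout.-+ x y 1+xq≡yt = subst (λ z → z ∼ b 0)
              (b-periodic (trans (cong (_% q) (sym 1+xq≡yt)) ([m+kn]%n≡m%n 1 x q)))
              (*-closed bt∼b0 y)
      ... | Bézout.+- x y 1+yt≡xq = ∼-sym (subst (λ z → z ∼ b 1)
              (b-periodic (trans (cong (_% q) 1+yt≡xq) ([m+kn]%n≡m%n 0 x q)))
              (shift 1 (*-closed bt∼b0 y)))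

transpose-applyˡ : (i j : Fin n) → PC.transpose i j i ≡ j
transpose-applyˡ i j with i ≟ i
... | yes _   = refl
... | no i≢i = ⊥-elim (i≢i refl)

transpose-applyʳ : (i j : Fin n) → PC.transpose i j j ≡ i
transpose-applyʳ i j with j ≟ i
... | yes j≡i = j≡i
... | no _ with j ≟ j
...   | yes _   = refl
...   | no j≢j = ⊥-elim (j≢j refl)

transpose-fixes : (i j : Fin n) {k : Fin n} → k ≢ i → k ≢ j → PC.transpose i j k ≡ k
transpose-fixes i j {k} k≢i k≢j with k ≟ i
... | yes k≡i = ⊥-elim (k≢i k≡i)
... | no _ with k ≟ j
...   | yes k≡j = ⊥-elim (k≢j k≡j)
...   | no _    = refl

transpose-self : (i : Fin n) → transpose i i ≈ id
transpose-self i k with k ≟ i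
... | yes k≡i = sym k≡i
... | no k≢i with k ≟ i
...   | yes k≡i = sym k≡i
...   | no _    = refl

permute-injective : (g : Permutation′ n) → Injective _≡_ _≡_ (g ⟨$⟩ʳ_)
permute-injective g = Injection.injective (↔⇒↣ g)

transpose-conj : (g : Permutation′ n) (i j : Fin n) →
                 flip g ∘ₚ transpose i j ∘ₚ g ≈ transpose (g ⟨$⟩ʳ i) (g ⟨$⟩ʳ j)
transpose-conj g i j y with y ≟ g ⟨$⟩ʳ i
... | yes refl = cong (g ⟨$⟩ʳ_) (trans (cong (PC.transpose i j) (inverseˡ g)) (transpose-applyˡ i j))
... | no y≢gi with y ≟ g ⟨$⟩ʳ j
...   | yes refl = cong (g ⟨$⟩ʳ_) (trans (cong (PC.transpose i j) (inverseˡ g)) (transpose-applyʳ i j))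
...   | no y≢gj  = trans (cong (g ⟨$⟩ʳ_) (transpose-fixes i j (moved y≢gi) (moved y≢gj))) (inverseʳ g)
  where
  moved : ∀ {x} → y ≢ g ⟨$⟩ʳ x → g ⟨$⟩ˡ y ≢ x
  moved y≢gx g⁻¹y≡x = y≢gx (trans (sym (inverseʳ g)) (cong (g ⟨$⟩ʳ_) g⁻¹y≡x))

2-cycle≈transpose : ∀ {τ : Permutation′ n} (a : Fin 2 → Fin n) →
                    (∀ i → τ ⟨$⟩ʳ a i ≡ a (cycSucc i)) → (∀ x → (∀ i → a i ≢ x) → τ ⟨$⟩ʳ x ≡ x) →
                    τ ≈ transpose (a zero) (a (suc zero))
2-cycle≈transpose a τ-a τ-fix y with y ≟ a zero
... | yes refl = τ-a zero
... | no y≢a₀ with y ≟ a (suc zero)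
...   | yes refl = τ-a (suc zero)
...   | no y≢a₁  = τ-fix y λ { zero a₀≡y → y≢a₀ (sym a₀≡y) ; (suc zero) a₁≡y → y≢a₁ (sym a₁≡y) }

module PermGroup {G : Permutation′ n → Set} (G-group : IsPermGroup G) where
  open IsPermGroup G-group

  infix 4 _∼_
  _∼_ : Rel (Fin n) _
  i ∼ j = G (transpose i j)

  ∼-conj : ∀ {g i j} → G g → i ∼ j → g ⟨$⟩ʳ i ∼ g ⟨$⟩ʳ j
  ∼-conj {g} {i} {j} g∈G i∼j = resp (transpose-conj g i j) (∘-mem (inv-mem g∈G) (∘-mem i∼j g∈G))

  ∼-refl : ∀ {i} → i ∼ i
  ∼-refl {i} = resp (λ k → sym (transpose-self i k)) id-mem

  -- Conjugating (i j) by itself gives (j i); for distinct i, j, k,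
  -- conjugating (j k) by (i j) gives (i k).
  ∼-sym : ∀ {i j} → i ∼ j → j ∼ i
  ∼-sym {i} {j} i∼j = subst₂ _∼_ (transpose-applyˡ i j) (transpose-applyʳ i j) (∼-conj i∼j i∼j)

  ∼-trans : ∀ {i j k} → i ∼ j → j ∼ k → i ∼ k
  ∼-trans {i} {j} {k} i∼j j∼k with i ≟ k | j ≟ k | i ≟ j
  ... | yes refl | _        | _        = ∼-refl
  ... | no _     | yes refl | _        = i∼j
  ... | no _     | no _     | yes refl = j∼k
  ... | no i≢k   | no j≢k   | no _     = subst₂ _∼_ (transpose-applyʳ i j)
          (transpose-fixes i j (λ k≡i → i≢k (sym k≡i)) (λ k≡j → j≢k (sym k≡j))) (∼-conj i∼j j∼k)

  ∼-isEquivalence : IsEquivalence _∼_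
  ∼-isEquivalence = record { refl = ∼-refl ; sym = ∼-sym ; trans = ∼-trans }

  ∼-total⇒complete : (∀ i j → i ∼ j) → ∀ π → G π
  ∼-total⇒complete ∼-total π = resp (eval-decompose π) (eval∈G (decompose π))
    where
    eval∈G : (xs : TranspositionList n) → G (eval xs)
    eval∈G []             = id-mem
    eval∈G ((i , j) ∷ xs) = ∘-mem (∼-total i j) (eval∈G xs)

  ClassSize≥ : ℕ → Fin n → Set
  ClassSize≥ p z = ∃ λ (f : Fin p → Fin n) → Injective _≡_ _≡_ f × (∀ i → f i ∼ z)

  transitive⇒ClassSize≥ : IsTransitive G → ∀ {p x} → ClassSize≥ p x → ∀ z → ClassSize≥ p z
  transitive⇒ClassSize≥ G-transitive (f , f-inj , f∼x) z with G-transitive _ z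
  ... | g , g∈G , gx≡z = (λ i → g ⟨$⟩ʳ f i)
                       , (λ gfi≡gfj → f-inj (permute-injective g gfi≡gfj))
                       , (λ i → subst (_ ∼_) gx≡z (∼-conj g∈G (f∼x i)))

  transitive⇒nontrivialClass : IsTransitive G → ∀ {x y} → x ∼ y → x ≢ y →
                               ∀ z → ∃ λ w → w ≢ z × z ∼ w
  transitive⇒nontrivialClass G-transitive {x} {y} x∼y x≢y z with G-transitive x z
  ... | g , g∈G , gx≡z = g ⟨$⟩ʳ y
                       , (λ gy≡z → x≢y (permute-injective g (trans gx≡z (sym gy≡z))))
                       , subst (_∼ _) gx≡z (∼-conj g∈G x∼y)

  module Cycle {σ} (σ∈G : G σ) {k} (a : Fin (suc k) → Fin n)
               (σ-a : ∀ i → σ ⟨$⟩ʳ a i ≡ a (cycSucc i)) where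

    orbit : ℕ → Fin n
    orbit i = a (i mod suc k)

    σ-orbit : ∀ i → σ ⟨$⟩ʳ orbit i ≡ orbit (suc i)
    σ-orbit i = trans (σ-a (i mod suc k)) (cong a (cycSucc-mod k i))

    orbit-periodic : ∀ i j → i % suc k ≡ j % suc k → orbit i ≡ orbit j
    orbit-periodic i j i≡j = cong a (mod-cong k i j i≡j)

    orbit-toℕ : ∀ j → orbit (toℕ j) ≡ a j
    orbit-toℕ j = cong a (toℕ-mod k j)

    orbit-∼-suc : ∀ {i j} → orbit i ∼ orbit j → orbit (suc i) ∼ orbit (suc j)
    orbit-∼-suc {i} {j} oi∼oj = subst₂ _∼_ (σ-orbit i) (σ-orbit j) (∼-conj σ∈G oi∼oj)

    fixed-related⇒support-related : ∀ {z j} → σ ⟨$⟩ʳ z ≡ z → a j ∼ z → ∀ i → a i ∼ z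
    fixed-related⇒support-related {z} {j} σz≡z aj∼z i = subst (_∼ z) (orbit-toℕ i)
      (successor-closed⇒all (suc k) (λ r → orbit r ∼ z)
        (λ {r} {s} r≡s → subst (_∼ z) (orbit-periodic r s r≡s))
        (λ {r} or∼z → subst₂ _∼_ (σ-orbit r) σz≡z (∼-conj σ∈G or∼z))
        (<⇒≤ (toℕ<n j)) (subst (_∼ z) (sym (orbit-toℕ j)) aj∼z) (toℕ i))

    module _ (σ-fix : ∀ x → (∀ i → a i ≢ x) → σ ⟨$⟩ʳ x ≡ x) where

      prime⇒support-connected : Prime (suc k) → ∀ {d} → a zero ∼ d → d ≢ a zero →
                                ∀ i → a i ∼ a zero
      prime⇒support-connected prime-length {d} a₀∼d d≢a₀ with any? (λ j → a j ≟ d)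
      ... | yes (zero , a₀≡d) = ⊥-elim (d≢a₀ (sym a₀≡d))
      ... | yes (suc j , aj≡d) = λ i → subst (_∼ a zero) (orbit-toℕ i)
              (coprime⇒connected (suc k) ∼-isEquivalence orbit (λ {r} {s} → orbit-periodic r s)
                orbit-∼-suc (prime⇒coprime prime-length (toℕ<n (suc j)))
                (subst (_∼ a zero) (sym (trans (orbit-toℕ (suc j)) aj≡d)) (∼-sym a₀∼d)) (toℕ i))
      ... | no d-outside = λ i → ∼-trans (fixed-related⇒support-related
              (σ-fix d (λ j aj≡d → d-outside (j , aj≡d))) a₀∼d i) (∼-sym a₀∼d)

      large-classes⇒total : Injective _≡_ _≡_ a → suc k < n → ∀ {p} → n < p + suc k →
                            (∀ z → ClassSize≥ p z) → ∀ x y → x ∼ y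
      large-classes⇒total a-inj k<n {p} n<p+k large x y = ∼-trans (∼x₀ x) (∼-sym (∼x₀ y))
        where
        outside⇒related : ∀ {z} → (∀ j → a j ≢ z) → ∀ i → a i ∼ z
        outside⇒related {z} z-outside with large z
        ... | f , f-inj , f∼z with injective-imagesMeet f-inj a-inj n<p+k
        ... | i , j , fi≡aj =
          fixed-related⇒support-related (σ-fix z z-outside) (subst (_∼ z) fi≡aj (f∼z i))

        x₀ : Fin n
        x₀ = proj₁ (injective⇒missesPoint a-inj k<n)

        x₀-outside : ∀ j → a j ≢ x₀
        x₀-outside = proj₂ (injective⇒missesPoint a-inj k<n)

        ∼x₀ : ∀ y → y ∼ x₀
        ∼x₀ y with any? (λ j → a j ≟ y)
        ... | yes (j , refl) = outside⇒related x₀-outside j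
        ... | no y-outside   = ∼-trans (∼-sym (outside⇒related (λ j aj≡y → y-outside (j , aj≡y)) zero))
                                       (outside⇒related x₀-outside zero)

proposition3p3 : (m : ℕ) → 2 ≤ m → (n : ℕ) → m < n
    → (G : Permutation′ n → Set) → IsPermGroup G
    → IsTransitive G
    → (∃ λ σ → G σ × (∃ λ k → IsCycleOfLength σ k × n ∸ m ≤ k × k < n))
    → (∃ λ τ → G τ × IsCycleOfLength τ 2)
    → (∃ λ q → Prime q × m < q × (∃ λ ρ → G ρ × IsCycleOfLength ρ q))
    → ∀ π → G π
proposition3p3 m _ n _ G G-group G-transitive
  (σ , σ∈G , suc k , (_ , e , e-inj , σ-e , σ-fix) , n∸m≤k , k<n)
  (τ , τ∈G , (_ , t , t-inj , τ-t , τ-fix))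
  (suc q , q-prime , m<q , ρ , ρ∈G , (_ , c , c-inj , ρ-c , ρ-fix)) =
  ∼-total⇒complete (Cycle.large-classes⇒total σ∈G e σ-e σ-fix e-inj k<n n<q+k classes)
  where
  open PermGroup G-group

  t₀∼t₁ : t zero ∼ t (suc zero)
  t₀∼t₁ = IsPermGroup.resp G-group (2-cycle≈transpose {τ = τ} t τ-t τ-fix) τ∈G

  t₀≢t₁ : t zero ≢ t (suc zero)
  t₀≢t₁ t₀≡t₁ with t-inj t₀≡t₁
  ... | ()

  classes : ∀ z → ClassSize≥ (suc q) z
  classes with transitive⇒nontrivialClass G-transitive t₀∼t₁ t₀≢t₁ (c zero)
  ... | d , d≢c₀ , c₀∼d = transitive⇒ClassSize≥ G-transitive
          (c , c-inj , Cycle.prime⇒support-connected ρ∈G c ρ-c ρ-fix q-prime c₀∼d d≢c₀)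

  n<q+k : n < suc q + suc k
  n<q+k = ≤-<-trans (m≤n+m∸n n m) (+-mono-<-≤ m<q n∸m≤k)
proposition3p3 _ _ _ _ _ _ _ (_ , _ , zero , (() , _) , _) _ _
proposition3p3 _ _ _ _ _ _ _ _ _ (zero , _ , _ , _ , _ , (() , _))
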